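{- Let $p,p',p''$ be odd primes with $p\neq p'$, and let $v,w$ be variables. Define in $\mathbb{Z}[1/2][v,w]$ the polynomials $f_\ell(v,w):=\tfrac12\left((v+w)^\ell+v^\ell-w^\ell\right)$ for $\ell\in\{p,p',p''\}$, $$f_{pp'p''}(v,w):=f_p\big(f_{p'}(f_{p''}(v,w),f_{p''}(w,v)),\,f_{p'}(f_{p''}(w,v),f_{p''}(v,w))\big),$$ with $f_{\ell_1\ell_2\ell_3}$ defined analogously for any ordering $(\ell_1,\ell_2,\ell_3)$ of $p,p',p''$, and $$g_{pp'p''}(v,w):=f_{pp'p''}(v,w)-f_{p'pp''}(v,w)-f_{p''pp'}(v,w)+f_{p''p'p}(v,w).$$ Then $g_{pp'p''}(v,w)\neq 0$. -}

module Defs where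

open import Data.Nat using (ℕ; zero; suc)
open import Data.List using (List; []; _∷_; map)
open import Data.List.Relation.Unary.All using (All)
open import Data.Rational using (ℚ; 0ℚ; 1ℚ; ½; _+_; _*_; -_)
open import Relation.Binary.PropositionalEquality using (_≡_)

-- Univariate polynomials over ℚ as coefficient lists (lowest degree first;
-- trailing zeros allowed).  Z[1/2] ⊂ ℚ, and the inclusion Z[1/2][v,w] → ℚ[v,w]
-- is injective, so nonvanishing may be tested in ℚ[v,w].
Poly1 : Set
Poly1 = List ℚ

add1 : Poly1 → Poly1 → Poly1
add1 [] q = q
add1 (a ∷ p) [] = a ∷ p
add1 (a ∷ p) (b ∷ q) = (a + b) ∷ add1 p q

mul1 : Poly1 → Poly1 → Poly1
mul1 [] q = []
mul1 (a ∷ p) q = add1 (map (a *_) q) (0ℚ ∷ mul1 p q)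

-- Bivariate polynomials in v,w: list indexed by the power of v, each entry a
-- polynomial in w.  Coefficient of v^i w^j is entry j of entry i.
Poly2 : Set
Poly2 = List Poly1

add2 : Poly2 → Poly2 → Poly2
add2 [] q = q
add2 (a ∷ p) [] = a ∷ p
add2 (a ∷ p) (b ∷ q) = add1 a b ∷ add2 p q

mul2 : Poly2 → Poly2 → Poly2
mul2 [] q = []
mul2 (a ∷ p) q = add2 (map (mul1 a) q) ([] ∷ mul2 p q)

scale2 : ℚ → Poly2 → Poly2
scale2 c = map (map (c *_))

neg2 : Poly2 → Poly2
neg2 = scale2 (- 1ℚ)

sub2 : Poly2 → Poly2 → Poly2
sub2 p q = add2 p (neg2 q)

one2 : Poly2
one2 = (1ℚ ∷ []) ∷ []

pow2 : Poly2 → ℕ → Poly2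
pow2 p zero = one2
pow2 p (suc n) = mul2 p (pow2 p n)

varV : Poly2
varV = [] ∷ (1ℚ ∷ []) ∷ []

varW : Poly2
varW = (0ℚ ∷ 1ℚ ∷ []) ∷ []

f : ℕ → Poly2 → Poly2 → Poly2
f ℓ A B = scale2 ½ (sub2 (add2 (pow2 (add2 A B) ℓ) (pow2 A ℓ)) (pow2 B ℓ))

f3 : ℕ → ℕ → ℕ → Poly2 → Poly2 → Poly2
f3 l₁ l₂ l₃ A B =
  f l₁ (f l₂ (f l₃ A B) (f l₃ B A)) (f l₂ (f l₃ B A) (f l₃ A B))

g : ℕ → ℕ → ℕ → Poly2
g p p' p'' =
  add2 (sub2 (sub2 (f3 p p' p'' varV varW) (f3 p' p p'' varV varW))
             (f3 p'' p p' varV varW))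
       (f3 p'' p' p varV varW)

IsZero2 : Poly2 → Set
IsZero2 P = All (All (_≡ 0ℚ)) P

module Submission where

-- Send v ↦ 1, w ↦ ε into the ring of jets ℚ[ε]/(ε³); this ring map commutes with every f_ℓ, so
-- it suffices to show that the image of g is nonzero.  For ℓ ≥ 3 a jet n = bε + dε² has
-- n^ℓ = 0, while u = 1 + aε + cε² has u^ℓ = 1 + ℓaε + (ℓc + ½ℓ(ℓ-1)a²)ε².  Hence f_ℓ(u, n) and
-- f_ℓ(n, u) are again of these two shapes, with coefficients polynomial in ℓ, and three such
-- steps starting from (1, ε) give f_{ℓ₁ℓ₂ℓ₃}(1, ε) explicitly.  In the alternating sum defining
-- g everything cancels except (1/64)·pp′p″(p′ - p)(p″ - 2)·ε², which is nonzero.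

open import Data.Integer using (+_)
open import Data.List using (List; []; _∷_; map)
open import Data.List.Relation.Unary.All as All using (All)
open import Data.Maybe using (Maybe; just; nothing)
open import Data.Nat as ℕ using (ℕ; zero; suc; _≤_; s≤s; z≤n)
open import Data.Nat.Divisibility using (_∣_; ∣-refl)
open import Data.Nat.Primality using (Prime; ¬prime[0]; ¬prime[1])
open import Data.Nat.Properties using (m<n⇒n≢0; >⇒≢)
open import Data.Rational
  using (ℚ; 0ℚ; 1ℚ; ½; _+_; _*_; -_; _-_; _/_; 1/_; Positive; NonZero; ≢-nonZero)
open import Data.Rational.Properties
  using ( _≟_; +-*-commutativeRing; +-0-group; +-identityˡ; +-identityʳ; *-identityʳ; *-assoc
        ; *-zeroˡ; *-zeroʳ; *-distribˡ-+; *-inverseʳ; <⇒≢; positive⁻¹; pos⇒nonNeg; pos+nonNeg⇒pos)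
open import Level using (0ℓ)
open import Relation.Binary.PropositionalEquality
  using (_≡_; _≢_; refl; sym; trans; cong; cong₂; ≢-sym; module ≡-Reasoning)
open import Relation.Nullary using (¬_; yes; no; contradiction)
open import Tactic.RingSolver using (solve)
open import Tactic.RingSolver.Core.AlmostCommutativeRing
  using (AlmostCommutativeRing; fromCommutativeRing)

open import Algebra.Properties.Group +-0-group
  using () renaming (∙-cancelˡ to +-cancelˡ; x∙y⁻¹≈ε⇒x≈y to x-y≡0⇒x≡y)

open import Defs

ℚ-ring : AlmostCommutativeRing 0ℓ 0ℓ
ℚ-ring = fromCommutativeRing +-*-commutativeRing isZero
  where
  isZero : (x : ℚ) → Maybe (0ℚ ≡ x)
  isZero x with 0ℚ ≟ x
  ... | yes 0≡x = just 0≡x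
  ... | no _    = nothing

fromℕ : ℕ → ℚ
fromℕ zero    = 0ℚ
fromℕ (suc n) = 1ℚ + fromℕ n

fromℕ-suc-positive : ∀ n → Positive (fromℕ (suc n))
fromℕ-suc-positive zero    = _
fromℕ-suc-positive (suc n) =
  pos+nonNeg⇒pos 1ℚ (fromℕ (suc n)) {{pos⇒nonNeg (fromℕ (suc n)) {{fromℕ-suc-positive n}}}}

fromℕ-suc≢0 : ∀ n → fromℕ (suc n) ≢ 0ℚ
fromℕ-suc≢0 n eq = <⇒≢ (positive⁻¹ (fromℕ (suc n)) {{fromℕ-suc-positive n}}) (sym eq)

fromℕ-injective : ∀ {m n} → fromℕ m ≡ fromℕ n → m ≡ n
fromℕ-injective {zero}  {zero}  _  = refl
fromℕ-injective {zero}  {suc n} eq = contradiction (sym eq) (fromℕ-suc≢0 n)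
fromℕ-injective {suc m} {zero}  eq = contradiction eq (fromℕ-suc≢0 m)
fromℕ-injective {suc m} {suc n} eq =
  cong suc (fromℕ-injective (+-cancelˡ 1ℚ (fromℕ m) (fromℕ n) eq))

fromℕ-≢0 : ∀ {n} → n ≢ 0 → fromℕ n ≢ 0ℚ
fromℕ-≢0 n≢0 eq = n≢0 (fromℕ-injective eq)

fromℕ-≢⇒-≢0 : ∀ {m n} → m ≢ n → fromℕ m - fromℕ n ≢ 0ℚ
fromℕ-≢⇒-≢0 m≢n eq = m≢n (fromℕ-injective (x-y≡0⇒x≡y _ _ eq))

*-≢0 : ∀ {p q} → p ≢ 0ℚ → q ≢ 0ℚ → p * q ≢ 0ℚ
*-≢0 {p} {q} p≢0 q≢0 pq≡0 = p≢0 (begin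
  p              ≡⟨ sym (*-identityʳ p) ⟩
  p * 1ℚ         ≡⟨ cong (p *_) (sym (*-inverseʳ q)) ⟩
  p * (q * 1/ q) ≡⟨ sym (*-assoc p q (1/ q)) ⟩
  p * q * 1/ q   ≡⟨ cong (_* 1/ q) pq≡0 ⟩
  0ℚ * 1/ q      ≡⟨ *-zeroˡ (1/ q) ⟩
  0ℚ             ∎)
  where
  open ≡-Reasoning
  instance
    q-nonZero : NonZero q
    q-nonZero = ≢-nonZero q≢0

odd-prime⇒3≤ : ∀ {p} → Prime p → ¬ (2 ∣ p) → 3 ≤ p
odd-prime⇒3≤ {0}                 p-prime _   = contradiction p-prime ¬prime[0]
odd-prime⇒3≤ {1}                 p-prime _   = contradiction p-prime ¬prime[1]
odd-prime⇒3≤ {2}                 _       2∤2 = contradiction ∣-refl 2∤2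
odd-prime⇒3≤ {suc (suc (suc _))} _       _   = s≤s (s≤s (s≤s z≤n))

-- ⟨ a , b , c ⟩ is a + bε + cε² in ℚ[ε]/(ε³).
data Jet : Set where
  ⟨_,_,_⟩ : ℚ → ℚ → ℚ → Jet

⟨⟩-cong : ∀ {a b c a′ b′ c′} → a ≡ a′ → b ≡ b′ → c ≡ c′ → ⟨ a , b , c ⟩ ≡ ⟨ a′ , b′ , c′ ⟩
⟨⟩-cong refl refl refl = refl

0ᴶ 1ᴶ ε : Jet
0ᴶ = ⟨ 0ℚ , 0ℚ , 0ℚ ⟩
1ᴶ = ⟨ 1ℚ , 0ℚ , 0ℚ ⟩
ε  = ⟨ 0ℚ , 1ℚ , 0ℚ ⟩

ε²-coefficient : Jet → ℚ
ε²-coefficient ⟨ _ , _ , c ⟩ = c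

infixl 6 _+ᴶ_ _-ᴶ_
infixl 7 _*ᴶ_ _·ᴶ_
infixr 5 _◃_

_+ᴶ_ : Jet → Jet → Jet
⟨ a , b , c ⟩ +ᴶ ⟨ a′ , b′ , c′ ⟩ = ⟨ a + a′ , b + b′ , c + c′ ⟩

_*ᴶ_ : Jet → Jet → Jet
⟨ a , b , c ⟩ *ᴶ ⟨ a′ , b′ , c′ ⟩ = ⟨ a * a′ , a * b′ + b * a′ , a * c′ + b * b′ + c * a′ ⟩

_·ᴶ_ : ℚ → Jet → Jet
k ·ᴶ ⟨ a , b , c ⟩ = ⟨ k * a , k * b , k * c ⟩

_-ᴶ_ : Jet → Jet → Jet
x -ᴶ y = x +ᴶ (- 1ℚ) ·ᴶ y

_^ᴶ_ : Jet → ℕ → Jet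
x ^ᴶ zero  = 1ᴶ
x ^ᴶ suc n = x *ᴶ x ^ᴶ n

-- a ◃ x = a + εx
_◃_ : ℚ → Jet → Jet
a ◃ ⟨ b , c , _ ⟩ = ⟨ a , b , c ⟩

+ᴶ-identityˡ : ∀ x → 0ᴶ +ᴶ x ≡ x
+ᴶ-identityˡ ⟨ a , b , c ⟩ = ⟨⟩-cong (+-identityˡ a) (+-identityˡ b) (+-identityˡ c)

+ᴶ-identityʳ : ∀ x → x +ᴶ 0ᴶ ≡ x
+ᴶ-identityʳ ⟨ a , b , c ⟩ = ⟨⟩-cong (+-identityʳ a) (+-identityʳ b) (+-identityʳ c)

+ᴶ-interchange : ∀ w x y z → (w +ᴶ x) +ᴶ (y +ᴶ z) ≡ (w +ᴶ y) +ᴶ (x +ᴶ z)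
+ᴶ-interchange ⟨ a , b , c ⟩ ⟨ a′ , b′ , c′ ⟩ ⟨ a″ , b″ , c″ ⟩ ⟨ a‴ , b‴ , c‴ ⟩ =
  ⟨⟩-cong (solve vars ℚ-ring) (solve vars ℚ-ring) (solve vars ℚ-ring)
  where
  vars : List ℚ
  vars = a ∷ b ∷ c ∷ a′ ∷ b′ ∷ c′ ∷ a″ ∷ b″ ∷ c″ ∷ a‴ ∷ b‴ ∷ c‴ ∷ []

*ᴶ-zeroˡ : ∀ x → 0ᴶ *ᴶ x ≡ 0ᴶ
*ᴶ-zeroˡ ⟨ a , b , c ⟩ =
  ⟨⟩-cong (solve vars ℚ-ring) (solve vars ℚ-ring) (solve vars ℚ-ring)
  where
  vars : List ℚ
  vars = a ∷ b ∷ c ∷ []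

*ᴶ-zeroʳ : ∀ x → x *ᴶ 0ᴶ ≡ 0ᴶ
*ᴶ-zeroʳ ⟨ a , b , c ⟩ =
  ⟨⟩-cong (solve vars ℚ-ring) (solve vars ℚ-ring) (solve vars ℚ-ring)
  where
  vars : List ℚ
  vars = a ∷ b ∷ c ∷ []

·ᴶ-zeroʳ : ∀ k → k ·ᴶ 0ᴶ ≡ 0ᴶ
·ᴶ-zeroʳ k = ⟨⟩-cong (*-zeroʳ k) (*-zeroʳ k) (*-zeroʳ k)

*ᴶ-distribˡ-+ᴶ : ∀ x y z → x *ᴶ (y +ᴶ z) ≡ x *ᴶ y +ᴶ x *ᴶ z
*ᴶ-distribˡ-+ᴶ ⟨ a , b , c ⟩ ⟨ a′ , b′ , c′ ⟩ ⟨ a″ , b″ , c″ ⟩ =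
  ⟨⟩-cong (solve vars ℚ-ring) (solve vars ℚ-ring) (solve vars ℚ-ring)
  where
  vars : List ℚ
  vars = a ∷ b ∷ c ∷ a′ ∷ b′ ∷ c′ ∷ a″ ∷ b″ ∷ c″ ∷ []

*ᴶ-distribʳ-+ᴶ : ∀ x y z → (y +ᴶ z) *ᴶ x ≡ y *ᴶ x +ᴶ z *ᴶ x
*ᴶ-distribʳ-+ᴶ ⟨ a , b , c ⟩ ⟨ a′ , b′ , c′ ⟩ ⟨ a″ , b″ , c″ ⟩ =
  ⟨⟩-cong (solve vars ℚ-ring) (solve vars ℚ-ring) (solve vars ℚ-ring)
  where
  vars : List ℚ
  vars = a ∷ b ∷ c ∷ a′ ∷ b′ ∷ c′ ∷ a″ ∷ b″ ∷ c″ ∷ []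

·ᴶ-distribˡ-+ᴶ : ∀ k x y → k ·ᴶ (x +ᴶ y) ≡ k ·ᴶ x +ᴶ k ·ᴶ y
·ᴶ-distribˡ-+ᴶ k ⟨ a , b , c ⟩ ⟨ a′ , b′ , c′ ⟩ =
  ⟨⟩-cong (*-distribˡ-+ k a a′) (*-distribˡ-+ k b b′) (*-distribˡ-+ k c c′)

◃-+ᴶ : ∀ a b x y → (a ◃ x) +ᴶ (b ◃ y) ≡ (a + b) ◃ (x +ᴶ y)
◃-+ᴶ a b ⟨ _ , _ , _ ⟩ ⟨ _ , _ , _ ⟩ = refl

◃-·ᴶ : ∀ k a x → k ·ᴶ (a ◃ x) ≡ (k * a) ◃ (k ·ᴶ x)
◃-·ᴶ k a ⟨ _ , _ , _ ⟩ = refl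

◃-*ᴶ : ∀ a x y → (a ◃ x) *ᴶ y ≡ a ·ᴶ y +ᴶ (0ℚ ◃ x *ᴶ y)
◃-*ᴶ a ⟨ b , c , _ ⟩ ⟨ a′ , b′ , c′ ⟩ =
  ⟨⟩-cong (solve vars ℚ-ring) (solve vars ℚ-ring) (solve vars ℚ-ring)
  where
  vars : List ℚ
  vars = a ∷ b ∷ c ∷ a′ ∷ b′ ∷ c′ ∷ []

-- The ring map ℚ[w] → ℚ[ε]/(ε³), w ↦ ε, and ℚ[v,w] → ℚ[ε]/(ε³), v ↦ 1, w ↦ ε.
⟦_⟧₁ : Poly1 → Jet
⟦ [] ⟧₁    = 0ᴶ
⟦ a ∷ p ⟧₁ = a ◃ ⟦ p ⟧₁

⟦_⟧ : Poly2 → Jet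
⟦ [] ⟧    = 0ᴶ
⟦ p ∷ P ⟧ = ⟦ p ⟧₁ +ᴶ ⟦ P ⟧

⟦⟧₁-+ : ∀ p q → ⟦ add1 p q ⟧₁ ≡ ⟦ p ⟧₁ +ᴶ ⟦ q ⟧₁
⟦⟧₁-+ []      q       = sym (+ᴶ-identityˡ ⟦ q ⟧₁)
⟦⟧₁-+ (a ∷ p) []      = sym (+ᴶ-identityʳ ⟦ a ∷ p ⟧₁)
⟦⟧₁-+ (a ∷ p) (b ∷ q) =
  trans (cong ((a + b) ◃_) (⟦⟧₁-+ p q)) (sym (◃-+ᴶ a b ⟦ p ⟧₁ ⟦ q ⟧₁))

⟦⟧₁-· : ∀ k p → ⟦ map (k *_) p ⟧₁ ≡ k ·ᴶ ⟦ p ⟧₁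
⟦⟧₁-· k []      = sym (·ᴶ-zeroʳ k)
⟦⟧₁-· k (a ∷ p) = trans (cong ((k * a) ◃_) (⟦⟧₁-· k p)) (sym (◃-·ᴶ k a ⟦ p ⟧₁))

⟦⟧₁-* : ∀ p q → ⟦ mul1 p q ⟧₁ ≡ ⟦ p ⟧₁ *ᴶ ⟦ q ⟧₁
⟦⟧₁-* []      q = sym (*ᴶ-zeroˡ ⟦ q ⟧₁)
⟦⟧₁-* (a ∷ p) q = begin
  ⟦ add1 (map (a *_) q) (0ℚ ∷ mul1 p q) ⟧₁
    ≡⟨ ⟦⟧₁-+ (map (a *_) q) (0ℚ ∷ mul1 p q) ⟩
  ⟦ map (a *_) q ⟧₁ +ᴶ (0ℚ ◃ ⟦ mul1 p q ⟧₁)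
    ≡⟨ cong₂ (λ s t → s +ᴶ (0ℚ ◃ t)) (⟦⟧₁-· a q) (⟦⟧₁-* p q) ⟩
  a ·ᴶ ⟦ q ⟧₁ +ᴶ (0ℚ ◃ ⟦ p ⟧₁ *ᴶ ⟦ q ⟧₁)
    ≡⟨ ◃-*ᴶ a ⟦ p ⟧₁ ⟦ q ⟧₁ ⟨
  (a ◃ ⟦ p ⟧₁) *ᴶ ⟦ q ⟧₁
    ∎
  where open ≡-Reasoning

⟦⟧-+ : ∀ P Q → ⟦ add2 P Q ⟧ ≡ ⟦ P ⟧ +ᴶ ⟦ Q ⟧
⟦⟧-+ []      Q       = sym (+ᴶ-identityˡ ⟦ Q ⟧)
⟦⟧-+ (p ∷ P) []      = sym (+ᴶ-identityʳ ⟦ p ∷ P ⟧)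
⟦⟧-+ (p ∷ P) (q ∷ Q) =
  trans (cong₂ _+ᴶ_ (⟦⟧₁-+ p q) (⟦⟧-+ P Q)) (+ᴶ-interchange ⟦ p ⟧₁ ⟦ q ⟧₁ ⟦ P ⟧ ⟦ Q ⟧)

⟦⟧-· : ∀ k P → ⟦ scale2 k P ⟧ ≡ k ·ᴶ ⟦ P ⟧
⟦⟧-· k []      = sym (·ᴶ-zeroʳ k)
⟦⟧-· k (p ∷ P) =
  trans (cong₂ _+ᴶ_ (⟦⟧₁-· k p) (⟦⟧-· k P)) (sym (·ᴶ-distribˡ-+ᴶ k ⟦ p ⟧₁ ⟦ P ⟧))

⟦⟧-*₁ : ∀ p Q → ⟦ map (mul1 p) Q ⟧ ≡ ⟦ p ⟧₁ *ᴶ ⟦ Q ⟧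
⟦⟧-*₁ p []      = sym (*ᴶ-zeroʳ ⟦ p ⟧₁)
⟦⟧-*₁ p (q ∷ Q) =
  trans (cong₂ _+ᴶ_ (⟦⟧₁-* p q) (⟦⟧-*₁ p Q)) (sym (*ᴶ-distribˡ-+ᴶ ⟦ p ⟧₁ ⟦ q ⟧₁ ⟦ Q ⟧))

⟦⟧-* : ∀ P Q → ⟦ mul2 P Q ⟧ ≡ ⟦ P ⟧ *ᴶ ⟦ Q ⟧
⟦⟧-* []      Q = sym (*ᴶ-zeroˡ ⟦ Q ⟧)
⟦⟧-* (p ∷ P) Q = begin
  ⟦ add2 (map (mul1 p) Q) ([] ∷ mul2 P Q) ⟧
    ≡⟨ ⟦⟧-+ (map (mul1 p) Q) ([] ∷ mul2 P Q) ⟩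
  ⟦ map (mul1 p) Q ⟧ +ᴶ (0ᴶ +ᴶ ⟦ mul2 P Q ⟧)
    ≡⟨ cong₂ _+ᴶ_ (⟦⟧-*₁ p Q) (trans (+ᴶ-identityˡ ⟦ mul2 P Q ⟧) (⟦⟧-* P Q)) ⟩
  ⟦ p ⟧₁ *ᴶ ⟦ Q ⟧ +ᴶ ⟦ P ⟧ *ᴶ ⟦ Q ⟧
    ≡⟨ *ᴶ-distribʳ-+ᴶ ⟦ Q ⟧ ⟦ p ⟧₁ ⟦ P ⟧ ⟨
  ⟦ p ∷ P ⟧ *ᴶ ⟦ Q ⟧
    ∎
  where open ≡-Reasoning

⟦⟧-^ : ∀ P n → ⟦ pow2 P n ⟧ ≡ ⟦ P ⟧ ^ᴶ n
⟦⟧-^ P zero    = refl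
⟦⟧-^ P (suc n) = trans (⟦⟧-* P (pow2 P n)) (cong (⟦ P ⟧ *ᴶ_) (⟦⟧-^ P n))

fᴶ : ℕ → Jet → Jet → Jet
fᴶ ℓ x y = ½ ·ᴶ (((x +ᴶ y) ^ᴶ ℓ +ᴶ x ^ᴶ ℓ) -ᴶ y ^ᴶ ℓ)

f3ᴶ : ℕ → ℕ → ℕ → Jet → Jet → Jet
f3ᴶ l₁ l₂ l₃ x y =
  fᴶ l₁ (fᴶ l₂ (fᴶ l₃ x y) (fᴶ l₃ y x)) (fᴶ l₂ (fᴶ l₃ y x) (fᴶ l₃ x y))

gᴶ : ℕ → ℕ → ℕ → Jet
gᴶ p p′ p″ =
  f3ᴶ p p′ p″ 1ᴶ ε -ᴶ f3ᴶ p′ p p″ 1ᴶ ε -ᴶ f3ᴶ p″ p p′ 1ᴶ ε +ᴶ f3ᴶ p″ p′ p 1ᴶ ε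

⟦⟧-sub : ∀ P Q → ⟦ sub2 P Q ⟧ ≡ ⟦ P ⟧ -ᴶ ⟦ Q ⟧
⟦⟧-sub P Q = trans (⟦⟧-+ P (neg2 Q)) (cong (⟦ P ⟧ +ᴶ_) (⟦⟧-· (- 1ℚ) Q))

fᴶ-from-powers : ∀ ℓ x y {s t z} → (x +ᴶ y) ^ᴶ ℓ ≡ s → x ^ᴶ ℓ ≡ t → y ^ᴶ ℓ ≡ z →
                 fᴶ ℓ x y ≡ ½ ·ᴶ ((s +ᴶ t) -ᴶ z)
fᴶ-from-powers ℓ x y refl refl refl = refl

⟦⟧-f : ∀ ℓ A B → ⟦ f ℓ A B ⟧ ≡ fᴶ ℓ ⟦ A ⟧ ⟦ B ⟧
⟦⟧-f ℓ A B = begin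
  ⟦ scale2 ½ (sub2 (add2 S T) U) ⟧   ≡⟨ ⟦⟧-· ½ (sub2 (add2 S T) U) ⟩
  ½ ·ᴶ ⟦ sub2 (add2 S T) U ⟧         ≡⟨ cong (½ ·ᴶ_) (⟦⟧-sub (add2 S T) U) ⟩
  ½ ·ᴶ (⟦ add2 S T ⟧ -ᴶ ⟦ U ⟧)       ≡⟨ cong (λ s → ½ ·ᴶ (s -ᴶ ⟦ U ⟧)) (⟦⟧-+ S T) ⟩
  ½ ·ᴶ ((⟦ S ⟧ +ᴶ ⟦ T ⟧) -ᴶ ⟦ U ⟧)
    ≡⟨ fᴶ-from-powers ℓ ⟦ A ⟧ ⟦ B ⟧ ⟦S⟧ (sym (⟦⟧-^ A ℓ)) (sym (⟦⟧-^ B ℓ)) ⟨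
  fᴶ ℓ ⟦ A ⟧ ⟦ B ⟧                   ∎
  where
  open ≡-Reasoning
  S T U : Poly2
  S = pow2 (add2 A B) ℓ
  T = pow2 A ℓ
  U = pow2 B ℓ
  ⟦S⟧ : (⟦ A ⟧ +ᴶ ⟦ B ⟧) ^ᴶ ℓ ≡ ⟦ S ⟧
  ⟦S⟧ = sym (trans (⟦⟧-^ (add2 A B) ℓ) (cong (_^ᴶ ℓ) (⟦⟧-+ A B)))

⟦⟧-f3 : ∀ l₁ l₂ l₃ A B → ⟦ f3 l₁ l₂ l₃ A B ⟧ ≡ f3ᴶ l₁ l₂ l₃ ⟦ A ⟧ ⟦ B ⟧
⟦⟧-f3 l₁ l₂ l₃ A B =
  trans (⟦⟧-f l₁ _ _) (cong₂ (fᴶ l₁) (⟦⟧-f2 A B) (⟦⟧-f2 B A))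
  where
  ⟦⟧-f2 : ∀ X Y → ⟦ f l₂ (f l₃ X Y) (f l₃ Y X) ⟧ ≡ fᴶ l₂ (fᴶ l₃ ⟦ X ⟧ ⟦ Y ⟧) (fᴶ l₃ ⟦ Y ⟧ ⟦ X ⟧)
  ⟦⟧-f2 X Y = trans (⟦⟧-f l₂ _ _) (cong₂ (fᴶ l₂) (⟦⟧-f l₃ X Y) (⟦⟧-f l₃ Y X))

-- ⟦ varV ⟧ and ⟦ varW ⟧ compute to 1ᴶ and ε.
⟦⟧-g : ∀ p p′ p″ → ⟦ g p p′ p″ ⟧ ≡ gᴶ p p′ p″
⟦⟧-g p p′ p″ = begin
  ⟦ add2 (sub2 (sub2 G₁ G₂) G₃) G₄ ⟧
    ≡⟨ ⟦⟧-+ (sub2 (sub2 G₁ G₂) G₃) G₄ ⟩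
  ⟦ sub2 (sub2 G₁ G₂) G₃ ⟧ +ᴶ ⟦ G₄ ⟧
    ≡⟨ cong (_+ᴶ ⟦ G₄ ⟧) (trans (⟦⟧-sub (sub2 G₁ G₂) G₃) (cong (_-ᴶ ⟦ G₃ ⟧) (⟦⟧-sub G₁ G₂))) ⟩
  ⟦ G₁ ⟧ -ᴶ ⟦ G₂ ⟧ -ᴶ ⟦ G₃ ⟧ +ᴶ ⟦ G₄ ⟧
    ≡⟨ cong₂ _+ᴶ_ (cong₂ _-ᴶ_ (cong₂ _-ᴶ_ (⟦⟧-f3 p p′ p″ varV varW) (⟦⟧-f3 p′ p p″ varV varW))
                             (⟦⟧-f3 p″ p p′ varV varW))
                  (⟦⟧-f3 p″ p′ p varV varW) ⟩
  gᴶ p p′ p″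
    ∎
  where
  open ≡-Reasoning
  G₁ G₂ G₃ G₄ : Poly2
  G₁ = f3 p p′ p″ varV varW
  G₂ = f3 p′ p p″ varV varW
  G₃ = f3 p″ p p′ varV varW
  G₄ = f3 p″ p′ p varV varW

⟦⟧₁-zero : ∀ p → All (_≡ 0ℚ) p → ⟦ p ⟧₁ ≡ 0ᴶ
⟦⟧₁-zero []      All.[]         = refl
⟦⟧₁-zero (a ∷ p) (refl All.∷ p≡0) = cong (0ℚ ◃_) (⟦⟧₁-zero p p≡0)

⟦⟧-zero : ∀ P → IsZero2 P → ⟦ P ⟧ ≡ 0ᴶ
⟦⟧-zero []      All.[]         = refl
⟦⟧-zero (p ∷ P) (p≡0 All.∷ P≡0) = cong₂ _+ᴶ_ (⟦⟧₁-zero p p≡0) (⟦⟧-zero P P≡0)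

unitPower : ℚ → ℚ → ℚ → Jet
unitPower N a c = ⟨ 1ℚ , N * a , N * c + ½ * (N * (N - 1ℚ)) * (a * a) ⟩

unitPower-suc : ∀ N a c → ⟨ 1ℚ , a , c ⟩ *ᴶ unitPower N a c ≡ unitPower (1ℚ + N) a c
unitPower-suc N a c =
  ⟨⟩-cong (solve vars ℚ-ring) (solve vars ℚ-ring) (solve vars ℚ-ring)
  where
  vars : List ℚ
  vars = N ∷ a ∷ c ∷ []

unit-^ᴶ : ∀ n a c → ⟨ 1ℚ , a , c ⟩ ^ᴶ n ≡ unitPower (fromℕ n) a c
unit-^ᴶ zero    a c = ⟨⟩-cong refl (solve (a ∷ []) ℚ-ring) (solve (a ∷ c ∷ []) ℚ-ring)
unit-^ᴶ (suc n) a c =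
  trans (cong (⟨ 1ℚ , a , c ⟩ *ᴶ_) (unit-^ᴶ n a c)) (unitPower-suc (fromℕ n) a c)

nilpotent-cube : ∀ b d x → ⟨ 0ℚ , b , d ⟩ *ᴶ (⟨ 0ℚ , b , d ⟩ *ᴶ (⟨ 0ℚ , b , d ⟩ *ᴶ x)) ≡ 0ᴶ
nilpotent-cube b d ⟨ a′ , b′ , c′ ⟩ =
  ⟨⟩-cong (solve vars ℚ-ring) (solve vars ℚ-ring) (solve vars ℚ-ring)
  where
  vars : List ℚ
  vars = b ∷ d ∷ a′ ∷ b′ ∷ c′ ∷ []

nilpotent-^ᴶ : ∀ {ℓ} → 3 ≤ ℓ → ∀ b d → ⟨ 0ℚ , b , d ⟩ ^ᴶ ℓ ≡ 0ᴶ
nilpotent-^ᴶ {suc (suc (suc k))} (s≤s (s≤s (s≤s _))) b d =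
  nilpotent-cube b d (⟨ 0ℚ , b , d ⟩ ^ᴶ k)

-- L stands for the image of ℓ in ℚ, kept abstract so that the ring solver can treat it as a
-- variable.
record Exponent (ℓ : ℕ) (L : ℚ) : Set where
  field
    unit-^      : ∀ a c → ⟨ 1ℚ , a , c ⟩ ^ᴶ ℓ ≡ unitPower L a c
    nilpotent-^ : ∀ b d → ⟨ 0ℚ , b , d ⟩ ^ᴶ ℓ ≡ 0ᴶ

exponent : ∀ {ℓ} → 3 ≤ ℓ → Exponent ℓ (fromℕ ℓ)
exponent {ℓ} 3≤ℓ = record { unit-^ = unit-^ᴶ ℓ ; nilpotent-^ = nilpotent-^ᴶ 3≤ℓ }

module _ {ℓ L} (e : Exponent ℓ L) where
  open Exponent e

  fᴶ-unit-nil : ∀ a b c d →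
    fᴶ ℓ ⟨ 1ℚ , a , c ⟩ ⟨ 0ℚ , b , d ⟩ ≡
    ⟨ 1ℚ , L * a + ½ * (L * b)
         , L * c + ½ * (L * d) + (+ 1 / 4) * (L * (L - 1ℚ)) * ((a + b) * (a + b) + a * a) ⟩
  fᴶ-unit-nil a b c d =
    trans (fᴶ-from-powers ℓ ⟨ 1ℚ , a , c ⟩ ⟨ 0ℚ , b , d ⟩
                          (unit-^ (a + b) (c + d)) (unit-^ a c) (nilpotent-^ b d))
          (⟨⟩-cong (solve vars ℚ-ring) (solve vars ℚ-ring) (solve vars ℚ-ring))
    where
    vars : List ℚ
    vars = L ∷ a ∷ b ∷ c ∷ d ∷ []

  fᴶ-nil-unit : ∀ a b c d →
    fᴶ ℓ ⟨ 0ℚ , b , d ⟩ ⟨ 1ℚ , a , c ⟩ ≡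
    ⟨ 0ℚ , ½ * (L * b) , ½ * (L * d) + (+ 1 / 4) * (L * (L - 1ℚ)) * ((a + b) * (a + b) - a * a) ⟩
  fᴶ-nil-unit a b c d =
    trans (fᴶ-from-powers ℓ ⟨ 0ℚ , b , d ⟩ ⟨ 1ℚ , a , c ⟩
                          (unit-^ (b + a) (d + c)) (nilpotent-^ b d) (unit-^ a c))
          (⟨⟩-cong (solve vars ℚ-ring) (solve vars ℚ-ring) (solve vars ℚ-ring))
    where
    vars : List ℚ
    vars = L ∷ a ∷ b ∷ c ∷ d ∷ []

f3ᴶ-at-1ε : ∀ {ℓ₁ ℓ₂ ℓ₃ P Q R} → Exponent ℓ₁ P → Exponent ℓ₂ Q → Exponent ℓ₃ R →
  f3ᴶ ℓ₁ ℓ₂ ℓ₃ 1ᴶ ε ≡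
  ⟨ 1ℚ , (+ 7 / 8) * (P * Q * R)
       , (+ 1 / 64) * (P * Q * R) * ((+ 25 / 1) * (P * Q * R) + Q * R + (+ 2 / 1) * R - (+ 28 / 1)) ⟩
f3ᴶ-at-1ε {ℓ₁} {ℓ₂} {ℓ₃} {P} {Q} {R} eP eQ eR = begin
  f3ᴶ ℓ₁ ℓ₂ ℓ₃ 1ᴶ ε
    ≡⟨ cong₂ (λ x y → fᴶ ℓ₁ (fᴶ ℓ₂ x y) (fᴶ ℓ₂ y x)) unit₁-eq nil₁-eq ⟩
  fᴶ ℓ₁ (fᴶ ℓ₂ unit₁ nil₁) (fᴶ ℓ₂ nil₁ unit₁)
    ≡⟨ cong₂ (fᴶ ℓ₁) unit₂-eq nil₂-eq ⟩
  fᴶ ℓ₁ unit₂ nil₂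
    ≡⟨ trans (fᴶ-unit-nil eP ((+ 3 / 4) * (Q * R)) ((+ 1 / 4) * (Q * R))
                             ((+ 3 / 8) * (Q * R * (R - 1ℚ)) + (+ 5 / 16) * (Q * (Q - 1ℚ) * (R * R)))
                             ((+ 1 / 8) * (Q * R * (R - 1ℚ)) + (+ 3 / 16) * (Q * (Q - 1ℚ) * (R * R))))
             (⟨⟩-cong refl (solve vars ℚ-ring) (solve vars ℚ-ring)) ⟩
  _ ∎
  where
  open ≡-Reasoning
  vars : List ℚ
  vars = P ∷ Q ∷ R ∷ []
  unit₁ nil₁ unit₂ nil₂ : Jet
  unit₁ = ⟨ 1ℚ , ½ * R , (+ 1 / 4) * (R * (R - 1ℚ)) ⟩
  nil₁  = ⟨ 0ℚ , ½ * R , (+ 1 / 4) * (R * (R - 1ℚ)) ⟩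
  unit₂ = ⟨ 1ℚ , (+ 3 / 4) * (Q * R)
               , (+ 3 / 8) * (Q * R * (R - 1ℚ)) + (+ 5 / 16) * (Q * (Q - 1ℚ) * (R * R)) ⟩
  nil₂  = ⟨ 0ℚ , (+ 1 / 4) * (Q * R)
               , (+ 1 / 8) * (Q * R * (R - 1ℚ)) + (+ 3 / 16) * (Q * (Q - 1ℚ) * (R * R)) ⟩
  unit₁-eq : fᴶ ℓ₃ 1ᴶ ε ≡ unit₁
  unit₁-eq = trans (fᴶ-unit-nil eR 0ℚ 1ℚ 0ℚ 0ℚ)
                   (⟨⟩-cong refl (solve vars ℚ-ring) (solve vars ℚ-ring))
  nil₁-eq : fᴶ ℓ₃ ε 1ᴶ ≡ nil₁
  nil₁-eq = trans (fᴶ-nil-unit eR 0ℚ 1ℚ 0ℚ 0ℚ)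
                  (⟨⟩-cong refl (solve vars ℚ-ring) (solve vars ℚ-ring))
  unit₂-eq : fᴶ ℓ₂ unit₁ nil₁ ≡ unit₂
  unit₂-eq = trans (fᴶ-unit-nil eQ (½ * R) (½ * R) ((+ 1 / 4) * (R * (R - 1ℚ)))
                                   ((+ 1 / 4) * (R * (R - 1ℚ))))
                   (⟨⟩-cong refl (solve vars ℚ-ring) (solve vars ℚ-ring))
  nil₂-eq : fᴶ ℓ₂ nil₁ unit₁ ≡ nil₂
  nil₂-eq = trans (fᴶ-nil-unit eQ (½ * R) (½ * R) ((+ 1 / 4) * (R * (R - 1ℚ)))
                                  ((+ 1 / 4) * (R * (R - 1ℚ))))
                  (⟨⟩-cong refl (solve vars ℚ-ring) (solve vars ℚ-ring))

gᴶ-closed-form : ∀ {ℓ₁ ℓ₂ ℓ₃ P Q R} → Exponent ℓ₁ P → Exponent ℓ₂ Q → Exponent ℓ₃ R →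
  gᴶ ℓ₁ ℓ₂ ℓ₃ ≡ ⟨ 0ℚ , 0ℚ , (+ 1 / 64) * (P * Q * R * (Q - P) * (R - fromℕ 2)) ⟩
gᴶ-closed-form {P = P} {Q} {R} eP eQ eR =
  trans (cong₂ _+ᴶ_ (cong₂ _-ᴶ_ (cong₂ _-ᴶ_ (f3ᴶ-at-1ε eP eQ eR) (f3ᴶ-at-1ε eQ eP eR))
                                 (f3ᴶ-at-1ε eR eP eQ))
                    (f3ᴶ-at-1ε eR eQ eP))
        (⟨⟩-cong refl (solve vars ℚ-ring) (solve vars ℚ-ring))
  where
  vars : List ℚ
  vars = P ∷ Q ∷ R ∷ []

gCoefficient : ℚ → ℚ → ℚ → ℚ
gCoefficient P Q R = (+ 1 / 64) * (P * Q * R * (Q - P) * (R - fromℕ 2))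

gCoefficient≢0 : ∀ {p p′ p″} → 3 ≤ p → 3 ≤ p′ → 3 ≤ p″ → p ≢ p′ →
                 gCoefficient (fromℕ p) (fromℕ p′) (fromℕ p″) ≢ 0ℚ
gCoefficient≢0 {p} {p′} {p″} 3≤p 3≤p′ 3≤p″ p≢p′ =
  *-≢0 {+ 1 / 64} (λ ())
    (*-≢0 {P * Q * R * (Q - P)}
      (*-≢0 {P * Q * R}
        (*-≢0 {P * Q} (*-≢0 {P} (fromℕ-≢0 (m<n⇒n≢0 3≤p)) (fromℕ-≢0 (m<n⇒n≢0 3≤p′)))
              (fromℕ-≢0 (m<n⇒n≢0 3≤p″)))
        (fromℕ-≢⇒-≢0 (≢-sym p≢p′)))
      (fromℕ-≢⇒-≢0 (>⇒≢ 3≤p″)))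
  where
  P Q R : ℚ
  P = fromℕ p
  Q = fromℕ p′
  R = fromℕ p″

lemma4p2 : (p p′ p″ : ℕ) → Prime p → Prime p′ → Prime p″ →
           ¬ (2 ∣ p) → ¬ (2 ∣ p′) → ¬ (2 ∣ p″) → p ≢ p′ →
           ¬ IsZero2 (g p p′ p″)
lemma4p2 p p′ p″ p-prime p′-prime p″-prime 2∤p 2∤p′ 2∤p″ p≢p′ g≡0 =
  gCoefficient≢0 3≤p 3≤p′ 3≤p″ p≢p′ (cong ε²-coefficient ⟦g⟧≡0)
  where
  3≤p : 3 ≤ p
  3≤p = odd-prime⇒3≤ p-prime 2∤p
  3≤p′ : 3 ≤ p′
  3≤p′ = odd-prime⇒3≤ p′-prime 2∤p′
  3≤p″ : 3 ≤ p″
  3≤p″ = odd-prime⇒3≤ p″-prime 2∤p″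
  ⟦g⟧≡0 : ⟨ 0ℚ , 0ℚ , gCoefficient (fromℕ p) (fromℕ p′) (fromℕ p″) ⟩ ≡ 0ᴶ
  ⟦g⟧≡0 = begin
    ⟨ 0ℚ , 0ℚ , gCoefficient (fromℕ p) (fromℕ p′) (fromℕ p″) ⟩
      ≡⟨ gᴶ-closed-form (exponent 3≤p) (exponent 3≤p′) (exponent 3≤p″) ⟨
    gᴶ p p′ p″
      ≡⟨ ⟦⟧-g p p′ p″ ⟨
    ⟦ g p p′ p″ ⟧
      ≡⟨ ⟦⟧-zero (g p p′ p″) g≡0 ⟩
    0ᴶ
      ∎
    where open ≡-Reasoning
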